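{- For any LF context, kind, type or canonical term $E$ and any substitution $\theta$, it is decidable whether there is an $E'$ such that $[\theta]E = E'$ is derivable; moreover there is at most one $E'$ for which it is derivable. Similarly, for any atomic term $R$ and substitution $\theta$, it is decidable whether there is an atomic term $R'$, or a canonical term $M'$ and arity type $\alpha'$, such that $[\theta]_r R = R'$, respectively $[\theta]_r R = M' : \alpha'$, is derivable; at most one of these two kinds of judgement is derivable, and that for a unique $R'$, respectively a unique pair $M'$, $\alpha'$.
   Context: Canonical LF syntax: kinds $K ::= \mathrm{Type} \mid \Pi x{:}A.K$; canonical types $A,B ::= P \mid \Pi x{:}A.B$; atomic types $P ::= a \mid P\,M$; canonical terms $M,N ::= R \mid \lambda x.M$; atomic terms $R ::= c \mid x \mid R\,M$; contexts $\Gamma ::= \cdot \mid \Gamma, x{:}A$. Here $c$ ranges over term constants, $a$ over type constants, $x,y$ over variables; expressions are identified up to renaming of bound variables. Arity types are generated from the constant $o$ by the binary constructor $\rightarrow$. A substitution $\theta$ is a finite set $\{\langle x_1,M_1,\alpha_1\rangle,\ldots,\langle x_n,M_n,\alpha_n\rangle\}$ with the $x_i$ distinct variables, $M_i$ canonical terms and $\alpha_i$ arity types; $\mathrm{dom}(\theta)=\{x_1,\ldots,x_n\}$, $\mathrm{rng}(\theta)=\{M_1,\ldots,M_n\}$. Hereditary substitution is given by the least relations closed under the following rules. Canonical terms: if $[\theta]_r R = R'$ then $[\theta]R = R'$; if $[\theta]_r R = M':\alpha'$ then $[\theta]R = M'$; if $x\notin\mathrm{dom}(\theta)$, $x$ is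 not free in any term of $\mathrm{rng}(\theta)$, and $[\theta]M=M'$, then $[\theta](\lambda x.M)=\lambda x.M'$. Atomic terms with canonical result: if $\langle x,M,\alpha\rangle\in\theta$ then $[\theta]_r x = M:\alpha$; if $[\theta]_r R = \lambda x.M' : \alpha'\rightarrow\alpha''$, $[\theta]M = M''$ and $[\{\langle x,M'',\alpha'\rangle\}]M' = M'''$ then $[\theta]_r(R\,M) = M''':\alpha''$. Atomic terms with atomic result: $[\theta]_r c = c$; if $x\notin\mathrm{dom}(\theta)$ then $[\theta]_r x = x$; if $[\theta]_r R=R'$ and $[\theta]M=M'$ then $[\theta]_r(R\,M)=R'\,M'$. Types: $[\theta]a=a$; if $[\theta]P=P'$ and $[\theta]M=M'$ then $[\theta](P\,M)=P'\,M'$; if $x$ is not in $\mathrm{dom}(\theta)$ nor free in $\mathrm{rng}(\theta)$, $[\theta]A_1=A_1'$ and $[\theta]A_2=A_2'$, then $[\theta](\Pi x{:}A_1.A_2)=\Pi x{:}A_1'.A_2'$. Kinds: $[\theta]\mathrm{Type}=\mathrm{Type}$ and the analogous $\Pi$ rule. Contexts: $[\theta]\cdot=\cdot$; if $x$ is not in $\mathrm{dom}(\theta)$ nor free in $\mathrm{rng}(\theta)$, $[\theta]\Gamma=\Gamma'$ and $[\theta]A=A'$, then $[\theta](\Gamma,x{:}A)=\Gamma',x{:}A'$. -}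

module Defs where

-- Canonical LF syntax in locally nameless representation:
-- free variables are named (ℕ), bound variables are de Bruijn indices,
-- so that syntactic equality is equality up to renaming of bound variables.

open import Data.Nat using (ℕ; zero; suc; _≡ᵇ_)
open import Data.Bool using (if_then_else_)
open import Data.List using (List; []; _∷_; _++_; map)
open import Data.List.Membership.Propositional using (_∈_; _∉_)
open import Data.List.Relation.Unary.All using (All)
open import Data.List.Relation.Unary.AllPairs using (AllPairs)
open import Data.Product using (_×_; _,_; proj₁)
open import Relation.Binary.PropositionalEquality using (_≢_)

Var : Set
Var = ℕ

Const : Set
Const = ℕ

mutual
  data Tm : Set where
    rt  : Atm → Tm
    lam : Tm → Tm          -- body binds de Bruijn index 0

  data Atm : Set where
    con  : Const → Atm
    fvar : Var → Atm
    bvar : ℕ → Atm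
    app  : Atm → Tm → Atm

data ATy : Set where
  tcon : Const → ATy
  tapp : ATy → Tm → ATy

data Ty : Set where
  at : ATy → Ty
  Pi : Ty → Ty → Ty        -- second component binds index 0

data Kind : Set where
  Type : Kind
  PiK  : Ty → Kind → Kind  -- second component binds index 0

data Ctx : Set where
  ·     : Ctx
  _,_∶_ : Ctx → Var → Ty → Ctx

data Arity : Set where
  o   : Arity
  _⇒_ : Arity → Arity → Arity

mutual
  fvTm : Tm → List Var
  fvTm (rt R)  = fvAtm R
  fvTm (lam M) = fvTm M

  fvAtm : Atm → List Var
  fvAtm (con c)   = []
  fvAtm (fvar x)  = x ∷ []
  fvAtm (bvar i)  = []
  fvAtm (app R M) = fvAtm R ++ fvTm M

fvATy : ATy → List Var
fvATy (tcon a)   = []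
fvATy (tapp P M) = fvATy P ++ fvTm M

fvTy : Ty → List Var
fvTy (at P)     = fvATy P
fvTy (Pi A B)   = fvTy A ++ fvTy B

fvKind : Kind → List Var
fvKind Type      = []
fvKind (PiK A K) = fvTy A ++ fvKind K

mutual
  openTm : ℕ → Var → Tm → Tm
  openTm k x (rt R)  = rt (openAtm k x R)
  openTm k x (lam M) = lam (openTm (suc k) x M)

  openAtm : ℕ → Var → Atm → Atm
  openAtm k x (con c)   = con c
  openAtm k x (fvar y)  = fvar y
  openAtm k x (bvar i)  = if i ≡ᵇ k then fvar x else bvar i
  openAtm k x (app R M) = app (openAtm k x R) (openTm k x M)

openATy : ℕ → Var → ATy → ATy
openATy k x (tcon a)   = tcon a
openATy k x (tapp P M) = tapp (openATy k x P) (openTm k x M)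

openTy : ℕ → Var → Ty → Ty
openTy k x (at P)   = at (openATy k x P)
openTy k x (Pi A B) = Pi (openTy k x A) (openTy (suc k) x B)

openKind : ℕ → Var → Kind → Kind
openKind k x Type      = Type
openKind k x (PiK A K) = PiK (openTy k x A) (openKind (suc k) x K)

mutual
  closeTm : ℕ → Var → Tm → Tm
  closeTm k x (rt R)  = rt (closeAtm k x R)
  closeTm k x (lam M) = lam (closeTm (suc k) x M)

  closeAtm : ℕ → Var → Atm → Atm
  closeAtm k x (con c)   = con c
  closeAtm k x (fvar y)  = if y ≡ᵇ x then bvar k else fvar y
  closeAtm k x (bvar i)  = bvar i
  closeAtm k x (app R M) = app (closeAtm k x R) (closeTm k x M)

closeATy : ℕ → Var → ATy → ATy
closeATy k x (tcon a)   = tcon a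
closeATy k x (tapp P M) = tapp (closeATy k x P) (closeTm k x M)

closeTy : ℕ → Var → Ty → Ty
closeTy k x (at P)   = at (closeATy k x P)
closeTy k x (Pi A B) = Pi (closeTy k x A) (closeTy (suc k) x B)

closeKind : ℕ → Var → Kind → Kind
closeKind k x Type      = Type
closeKind k x (PiK A K) = PiK (closeTy k x A) (closeKind (suc k) x K)

Subst : Set
Subst = List (Var × Tm × Arity)

dom : Subst → List Var
dom = map proj₁

IsSubst : Subst → Set
IsSubst θ = AllPairs _≢_ (dom θ)

Fresh : Var → Subst → Set
Fresh x θ = x ∉ dom θ × All (λ t → x ∉ fvTm (proj₁ (Data.Product.proj₂ t))) θ

mutual
  data HSTm (θ : Subst) : Tm → Tm → Set where
    hs-at  : ∀ {R R'} → HSAtmA θ R R' → HSTm θ (rt R) (rt R')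
    hs-can : ∀ {R M' α'} → HSAtmC θ R M' α' → HSTm θ (rt R) M'
    -- λx.M with x chosen fresh (representative of the α-class)
    hs-lam : ∀ {M N} x → Fresh x θ → x ∉ fvTm M →
             HSTm θ (openTm 0 x M) N →
             HSTm θ (lam M) (lam (closeTm 0 x N))

  data HSAtmC (θ : Subst) : Atm → Tm → Arity → Set where
    hsc-var : ∀ {x M α} → (x , M , α) ∈ θ → HSAtmC θ (fvar x) M α
    hsc-app : ∀ {R M body α' α'' M'' M'''} →
              HSAtmC θ R (lam body) (α' ⇒ α'') →
              HSTm θ M M'' →
              (x : Var) → x ∉ fvTm body →
              HSTm ((x , M'' , α') ∷ []) (openTm 0 x body) M''' →
              HSAtmC θ (app R M) M''' α''

  data HSAtmA (θ : Subst) : Atm → Atm → Set where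
    hsa-con : ∀ {c} → HSAtmA θ (con c) (con c)
    hsa-var : ∀ {x} → x ∉ dom θ → HSAtmA θ (fvar x) (fvar x)
    hsa-app : ∀ {R R' M M'} → HSAtmA θ R R' → HSTm θ M M' →
              HSAtmA θ (app R M) (app R' M')

data HSATy (θ : Subst) : ATy → ATy → Set where
  hs-tcon : ∀ {a} → HSATy θ (tcon a) (tcon a)
  hs-tapp : ∀ {P P' M M'} → HSATy θ P P' → HSTm θ M M' →
            HSATy θ (tapp P M) (tapp P' M')

data HSTy (θ : Subst) : Ty → Ty → Set where
  hs-atTy : ∀ {P P'} → HSATy θ P P' → HSTy θ (at P) (at P')
  hs-Pi   : ∀ {A₁ A₁' A₂ A₂'} x → Fresh x θ → x ∉ fvTy A₂ →
            HSTy θ A₁ A₁' → HSTy θ (openTy 0 x A₂) A₂' →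
            HSTy θ (Pi A₁ A₂) (Pi A₁' (closeTy 0 x A₂'))

data HSKind (θ : Subst) : Kind → Kind → Set where
  hs-Type : HSKind θ Type Type
  hs-PiK  : ∀ {A A' K K'} x → Fresh x θ → x ∉ fvKind K →
            HSTy θ A A' → HSKind θ (openKind 0 x K) K' →
            HSKind θ (PiK A K) (PiK A' (closeKind 0 x K'))

data HSCtx (θ : Subst) : Ctx → Ctx → Set where
  hs-emp  : HSCtx θ · ·
  hs-snoc : ∀ {Γ Γ' x A A'} → Fresh x θ →
            HSCtx θ Γ Γ' → HSTy θ A A' →
            HSCtx θ (Γ , x ∶ A) (Γ' , x ∶ A')

{-# OPTIONS --safe #-}
-- Every rule of hereditary substitution is determined by the shape of its input
-- except for two choices of names: the fresh binder in the λ and Π rules, and the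
-- name x of the inner substitution ⟨x, M'', α'⟩ in the application rule. Neither
-- matters. The judgements are equivariant under swapping names, and swapping two
-- names fresh for θ fixes θ, so a derivation with one fresh binder yields one with
-- any other. Renaming a name that does not occur in a λ-body transports a
-- single-substitution derivation, so the inner name is irrelevant too. Uniqueness
-- is then an induction on derivations, and deciding is running the rules: by size
-- within one substitution, and by arity depth across an inner substitution.
module Submission where

open import Defs
open import Data.Bool using (true; false; if_then_else_)
open import Data.Bool.Properties using (T-≡; ¬-not)
open import Data.Empty using (⊥-elim)
open import Data.List using (List; []; _∷_; _++_; map)
open import Data.List.Extrema.Nat using (max; xs≤max)
open import Data.List.Membership.Propositional using (_∈_; _∉_)
open import Data.List.Membership.Propositional.Properties using (∈-map⁺; ∈-map⁻; ∈-++⁺ˡ; ∈-++⁺ʳ; ∈-++⁻)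
open import Data.List.Properties using (map-++; ++-identityʳ)
open import Data.List.Relation.Binary.Subset.Propositional using (_⊆_)
open import Data.List.Relation.Binary.Subset.Propositional.Properties using (++⁺; xs⊆xs++ys; xs⊆ys++xs)
open import Data.List.Relation.Unary.All as All using (All; []; _∷_; all?)
open import Data.List.Relation.Unary.All.Properties using () renaming (map⁻ to All-map⁻)
open import Data.List.Relation.Unary.AllPairs using ([]; _∷_)
open import Data.List.Relation.Unary.Any using (here; there)
open import Data.Nat using (ℕ; suc; _≡ᵇ_; _+_; _≤_; _<_; s≤s; _⊔_)
open import Data.Nat.Properties
  using (_≟_; ≡ᵇ⇒≡; ≡⇒≡ᵇ; ≤-refl; ≤-trans; <-trans; m≤m+n; m≤n+m; m≤m⊔n; m≤n⊔m; 1+n≰n)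
open import Data.List.Membership.DecPropositional _≟_ using (_∈?_)
open import Data.Product using (_×_; _,_; ∃; ∃₂; proj₁; proj₂)
open import Data.Sum using (_⊎_; inj₁; inj₂)
open import Function using (_∘_)
open import Function.Bundles using (Equivalence)
open import Relation.Binary.PropositionalEquality
open import Relation.Nullary using (Dec; yes; no; ¬_)
open import Relation.Nullary.Decidable using (¬?; _×-dec_; map′)

variable
  θ : Subst
  a b x y z w : Var
  xs xs' ys ys' : List Var
  M N : Tm
  R : Atm
  α : Arity

≡ᵇ-refl : ∀ x → (x ≡ᵇ x) ≡ true
≡ᵇ-refl x = Equivalence.to T-≡ (≡⇒≡ᵇ x x refl)

≢⇒≡ᵇ-false : x ≢ y → (x ≡ᵇ y) ≡ false
≢⇒≡ᵇ-false {x} {y} x≢y = ¬-not (x≢y ∘ ≡ᵇ⇒≡ x y ∘ Equivalence.from T-≡)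

∉-++ : x ∉ xs → x ∉ ys → x ∉ xs ++ ys
∉-++ {xs = xs} x∉xs x∉ys x∈ with ∈-++⁻ xs x∈
... | inj₁ x∈xs = x∉xs x∈xs
... | inj₂ x∈ys = x∉ys x∈ys

∉-++ˡ : x ∉ xs ++ ys → x ∉ xs
∉-++ˡ x∉ = x∉ ∘ ∈-++⁺ˡ

∉-++ʳ : ∀ xs → x ∉ xs ++ ys → x ∉ ys
∉-++ʳ xs x∉ = x∉ ∘ ∈-++⁺ʳ xs

⊆∷-++ : xs ⊆ z ∷ xs' → ys ⊆ z ∷ ys' → xs ++ ys ⊆ z ∷ xs' ++ ys'
⊆∷-++ {xs = xs} {xs' = xs'} xs⊆ ys⊆ m with ∈-++⁻ xs m
... | inj₁ m₁ with xs⊆ m₁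
...   | here e  = here e
...   | there m₂ = there (∈-++⁺ˡ m₂)
⊆∷-++ {xs = xs} {xs' = xs'} xs⊆ ys⊆ m | inj₂ m₁ with ys⊆ m₁
...   | here e  = here e
...   | there m₂ = there (∈-++⁺ʳ xs' m₂)

∉-⊆∷ : xs ⊆ z ∷ ys → y ≢ z → y ∉ ys → y ∉ xs
∉-⊆∷ xs⊆ y≢z y∉ys y∈ with xs⊆ y∈
... | here e   = y≢z e
... | there m  = y∉ys m

swapVar : Var → Var → Var → Var
swapVar a b x = if x ≡ᵇ a then b else (if x ≡ᵇ b then a else x)

swapVar-left : ∀ a b → swapVar a b a ≡ b
swapVar-left a b rewrite ≡ᵇ-refl a = refl

swapVar-right : ∀ a b → swapVar a b b ≡ a
swapVar-right a b with b ≟ a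
... | yes refl rewrite ≡ᵇ-refl a = refl
... | no b≢a rewrite ≢⇒≡ᵇ-false b≢a | ≡ᵇ-refl b = refl

swapVar-other : x ≢ a → x ≢ b → swapVar a b x ≡ x
swapVar-other x≢a x≢b rewrite ≢⇒≡ᵇ-false x≢a | ≢⇒≡ᵇ-false x≢b = refl

swapVar-involutive : ∀ a b x → swapVar a b (swapVar a b x) ≡ x
swapVar-involutive a b x with x ≟ a
... | yes refl rewrite swapVar-left x b = swapVar-right x b
... | no x≢a with x ≟ b
...   | yes refl rewrite swapVar-right a x = swapVar-left a x
...   | no x≢b rewrite swapVar-other x≢a x≢b = swapVar-other x≢a x≢b

swapVar-injective : swapVar a b x ≡ swapVar a b y → x ≡ y
swapVar-injective {a} {b} {x} {y} eq = begin
  x                             ≡⟨ sym (swapVar-involutive a b x) ⟩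
  swapVar a b (swapVar a b x)   ≡⟨ cong (swapVar a b) eq ⟩
  swapVar a b (swapVar a b y)   ≡⟨ swapVar-involutive a b y ⟩
  y                             ∎
  where open ≡-Reasoning

swapVar-≡ᵇ : ∀ a b x y → (swapVar a b x ≡ᵇ swapVar a b y) ≡ (x ≡ᵇ y)
swapVar-≡ᵇ a b x y with x ≟ y
... | yes refl rewrite ≡ᵇ-refl x | ≡ᵇ-refl (swapVar a b x) = refl
... | no x≢y rewrite ≢⇒≡ᵇ-false x≢y
                   | ≢⇒≡ᵇ-false (x≢y ∘ swapVar-injective {a} {b}) = refl

swapVar-∉ : x ∉ xs → swapVar a b x ∉ map (swapVar a b) xs
swapVar-∉ {a = a} {b} x∉ m with ∈-map⁻ (swapVar a b) m
... | y , y∈ , eq = x∉ (subst (_∈ _) (sym (swapVar-injective {a} {b} eq)) y∈)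

mutual
  swapTm : Var → Var → Tm → Tm
  swapTm a b (rt R)  = rt (swapAtm a b R)
  swapTm a b (lam M) = lam (swapTm a b M)

  swapAtm : Var → Var → Atm → Atm
  swapAtm a b (con c)   = con c
  swapAtm a b (fvar x)  = fvar (swapVar a b x)
  swapAtm a b (bvar i)  = bvar i
  swapAtm a b (app R M) = app (swapAtm a b R) (swapTm a b M)

swapATy : Var → Var → ATy → ATy
swapATy a b (tcon c)   = tcon c
swapATy a b (tapp P M) = tapp (swapATy a b P) (swapTm a b M)

swapTy : Var → Var → Ty → Ty
swapTy a b (at P)   = at (swapATy a b P)
swapTy a b (Pi A B) = Pi (swapTy a b A) (swapTy a b B)

swapKind : Var → Var → Kind → Kind
swapKind a b Type      = Type
swapKind a b (PiK A K) = PiK (swapTy a b A) (swapKind a b K)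

swapSubst : Var → Var → Subst → Subst
swapSubst a b = map λ { (x , M , α) → swapVar a b x , swapTm a b M , α }

mutual
  swapTm-openTm : ∀ a b k x M → swapTm a b (openTm k x M) ≡ openTm k (swapVar a b x) (swapTm a b M)
  swapTm-openTm a b k x (rt R)  = cong rt (swapAtm-openAtm a b k x R)
  swapTm-openTm a b k x (lam M) = cong lam (swapTm-openTm a b (suc k) x M)

  swapAtm-openAtm : ∀ a b k x R → swapAtm a b (openAtm k x R) ≡ openAtm k (swapVar a b x) (swapAtm a b R)
  swapAtm-openAtm a b k x (con c)   = refl
  swapAtm-openAtm a b k x (fvar y)  = refl
  swapAtm-openAtm a b k x (bvar i) with i ≡ᵇ k
  ... | true  = refl
  ... | false = refl
  swapAtm-openAtm a b k x (app R M) = cong₂ app (swapAtm-openAtm a b k x R) (swapTm-openTm a b k x M)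

swapATy-openATy : ∀ a b k x P → swapATy a b (openATy k x P) ≡ openATy k (swapVar a b x) (swapATy a b P)
swapATy-openATy a b k x (tcon c)   = refl
swapATy-openATy a b k x (tapp P M) = cong₂ tapp (swapATy-openATy a b k x P) (swapTm-openTm a b k x M)

swapTy-openTy : ∀ a b k x A → swapTy a b (openTy k x A) ≡ openTy k (swapVar a b x) (swapTy a b A)
swapTy-openTy a b k x (at P)   = cong at (swapATy-openATy a b k x P)
swapTy-openTy a b k x (Pi A B) = cong₂ Pi (swapTy-openTy a b k x A) (swapTy-openTy a b (suc k) x B)

swapKind-openKind : ∀ a b k x K → swapKind a b (openKind k x K) ≡ openKind k (swapVar a b x) (swapKind a b K)
swapKind-openKind a b k x Type      = refl
swapKind-openKind a b k x (PiK A K) = cong₂ PiK (swapTy-openTy a b k x A) (swapKind-openKind a b (suc k) x K)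

mutual
  swapTm-closeTm : ∀ a b k x M → swapTm a b (closeTm k x M) ≡ closeTm k (swapVar a b x) (swapTm a b M)
  swapTm-closeTm a b k x (rt R)  = cong rt (swapAtm-closeAtm a b k x R)
  swapTm-closeTm a b k x (lam M) = cong lam (swapTm-closeTm a b (suc k) x M)

  swapAtm-closeAtm : ∀ a b k x R → swapAtm a b (closeAtm k x R) ≡ closeAtm k (swapVar a b x) (swapAtm a b R)
  swapAtm-closeAtm a b k x (con c)   = refl
  swapAtm-closeAtm a b k x (fvar y) rewrite swapVar-≡ᵇ a b y x with y ≡ᵇ x
  ... | true  = refl
  ... | false = refl
  swapAtm-closeAtm a b k x (bvar i)  = refl
  swapAtm-closeAtm a b k x (app R M) = cong₂ app (swapAtm-closeAtm a b k x R) (swapTm-closeTm a b k x M)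

swapATy-closeATy : ∀ a b k x P → swapATy a b (closeATy k x P) ≡ closeATy k (swapVar a b x) (swapATy a b P)
swapATy-closeATy a b k x (tcon c)   = refl
swapATy-closeATy a b k x (tapp P M) = cong₂ tapp (swapATy-closeATy a b k x P) (swapTm-closeTm a b k x M)

swapTy-closeTy : ∀ a b k x A → swapTy a b (closeTy k x A) ≡ closeTy k (swapVar a b x) (swapTy a b A)
swapTy-closeTy a b k x (at P)   = cong at (swapATy-closeATy a b k x P)
swapTy-closeTy a b k x (Pi A B) = cong₂ Pi (swapTy-closeTy a b k x A) (swapTy-closeTy a b (suc k) x B)

swapKind-closeKind : ∀ a b k x K → swapKind a b (closeKind k x K) ≡ closeKind k (swapVar a b x) (swapKind a b K)
swapKind-closeKind a b k x Type      = refl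
swapKind-closeKind a b k x (PiK A K) = cong₂ PiK (swapTy-closeTy a b k x A) (swapKind-closeKind a b (suc k) x K)

mutual
  fv-swapTm : ∀ a b M → fvTm (swapTm a b M) ≡ map (swapVar a b) (fvTm M)
  fv-swapTm a b (rt R)  = fv-swapAtm a b R
  fv-swapTm a b (lam M) = fv-swapTm a b M

  fv-swapAtm : ∀ a b R → fvAtm (swapAtm a b R) ≡ map (swapVar a b) (fvAtm R)
  fv-swapAtm a b (con c)   = refl
  fv-swapAtm a b (fvar x)  = refl
  fv-swapAtm a b (bvar i)  = refl
  fv-swapAtm a b (app R M) =
    trans (cong₂ _++_ (fv-swapAtm a b R) (fv-swapTm a b M)) (sym (map-++ _ (fvAtm R) (fvTm M)))

fv-swapATy : ∀ a b P → fvATy (swapATy a b P) ≡ map (swapVar a b) (fvATy P)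
fv-swapATy a b (tcon c)   = refl
fv-swapATy a b (tapp P M) =
  trans (cong₂ _++_ (fv-swapATy a b P) (fv-swapTm a b M)) (sym (map-++ _ (fvATy P) (fvTm M)))

fv-swapTy : ∀ a b A → fvTy (swapTy a b A) ≡ map (swapVar a b) (fvTy A)
fv-swapTy a b (at P)   = fv-swapATy a b P
fv-swapTy a b (Pi A B) =
  trans (cong₂ _++_ (fv-swapTy a b A) (fv-swapTy a b B)) (sym (map-++ _ (fvTy A) (fvTy B)))

fv-swapKind : ∀ a b K → fvKind (swapKind a b K) ≡ map (swapVar a b) (fvKind K)
fv-swapKind a b Type      = refl
fv-swapKind a b (PiK A K) =
  trans (cong₂ _++_ (fv-swapTy a b A) (fv-swapKind a b K)) (sym (map-++ _ (fvTy A) (fvKind K)))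

mutual
  swapTm-fresh : ∀ M → a ∉ fvTm M → b ∉ fvTm M → swapTm a b M ≡ M
  swapTm-fresh (rt R)  a∉ b∉ = cong rt (swapAtm-fresh R a∉ b∉)
  swapTm-fresh (lam M) a∉ b∉ = cong lam (swapTm-fresh M a∉ b∉)

  swapAtm-fresh : ∀ R → a ∉ fvAtm R → b ∉ fvAtm R → swapAtm a b R ≡ R
  swapAtm-fresh (con c)   a∉ b∉ = refl
  swapAtm-fresh (fvar x)  a∉ b∉ = cong fvar (swapVar-other (a∉ ∘ here ∘ sym) (b∉ ∘ here ∘ sym))
  swapAtm-fresh (bvar i)  a∉ b∉ = refl
  swapAtm-fresh (app R M) a∉ b∉ =
    cong₂ app (swapAtm-fresh R (∉-++ˡ a∉) (∉-++ˡ b∉))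
              (swapTm-fresh M (∉-++ʳ (fvAtm R) a∉) (∉-++ʳ (fvAtm R) b∉))

swapATy-fresh : ∀ P → a ∉ fvATy P → b ∉ fvATy P → swapATy a b P ≡ P
swapATy-fresh (tcon c)   a∉ b∉ = refl
swapATy-fresh (tapp P M) a∉ b∉ =
  cong₂ tapp (swapATy-fresh P (∉-++ˡ a∉) (∉-++ˡ b∉))
             (swapTm-fresh M (∉-++ʳ (fvATy P) a∉) (∉-++ʳ (fvATy P) b∉))

swapTy-fresh : ∀ A → a ∉ fvTy A → b ∉ fvTy A → swapTy a b A ≡ A
swapTy-fresh (at P)   a∉ b∉ = cong at (swapATy-fresh P a∉ b∉)
swapTy-fresh (Pi A B) a∉ b∉ =
  cong₂ Pi (swapTy-fresh A (∉-++ˡ a∉) (∉-++ˡ b∉))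
           (swapTy-fresh B (∉-++ʳ (fvTy A) a∉) (∉-++ʳ (fvTy A) b∉))

swapKind-fresh : ∀ K → a ∉ fvKind K → b ∉ fvKind K → swapKind a b K ≡ K
swapKind-fresh Type      a∉ b∉ = refl
swapKind-fresh (PiK A K) a∉ b∉ =
  cong₂ PiK (swapTy-fresh A (∉-++ˡ a∉) (∉-++ˡ b∉))
            (swapKind-fresh K (∉-++ʳ (fvTy A) a∉) (∉-++ʳ (fvTy A) b∉))

mutual
  fv-openTm-⊆ : ∀ k x M → fvTm (openTm k x M) ⊆ x ∷ fvTm M
  fv-openTm-⊆ k x (rt R)  = fv-openAtm-⊆ k x R
  fv-openTm-⊆ k x (lam M) = fv-openTm-⊆ (suc k) x M

  fv-openAtm-⊆ : ∀ k x R → fvAtm (openAtm k x R) ⊆ x ∷ fvAtm R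
  fv-openAtm-⊆ k x (con c) ()
  fv-openAtm-⊆ k x (fvar y) = there
  fv-openAtm-⊆ k x (bvar i) with i ≡ᵇ k
  ... | true  = λ m → m
  ... | false = λ ()
  fv-openAtm-⊆ k x (app R M) = ⊆∷-++ (fv-openAtm-⊆ k x R) (fv-openTm-⊆ k x M)

fv-openATy-⊆ : ∀ k x P → fvATy (openATy k x P) ⊆ x ∷ fvATy P
fv-openATy-⊆ k x (tcon c) ()
fv-openATy-⊆ k x (tapp P M) = ⊆∷-++ (fv-openATy-⊆ k x P) (fv-openTm-⊆ k x M)

fv-openTy-⊆ : ∀ k x A → fvTy (openTy k x A) ⊆ x ∷ fvTy A
fv-openTy-⊆ k x (at P)   = fv-openATy-⊆ k x P
fv-openTy-⊆ k x (Pi A B) = ⊆∷-++ (fv-openTy-⊆ k x A) (fv-openTy-⊆ (suc k) x B)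

fv-openKind-⊆ : ∀ k x K → fvKind (openKind k x K) ⊆ x ∷ fvKind K
fv-openKind-⊆ k x Type ()
fv-openKind-⊆ k x (PiK A K) = ⊆∷-++ (fv-openTy-⊆ k x A) (fv-openKind-⊆ (suc k) x K)

mutual
  fv-closeTm-⊆ : ∀ k x M → fvTm (closeTm k x M) ⊆ fvTm M
  fv-closeTm-⊆ k x (rt R)  = fv-closeAtm-⊆ k x R
  fv-closeTm-⊆ k x (lam M) = fv-closeTm-⊆ (suc k) x M

  fv-closeAtm-⊆ : ∀ k x R → fvAtm (closeAtm k x R) ⊆ fvAtm R
  fv-closeAtm-⊆ k x (con c) ()
  fv-closeAtm-⊆ k x (fvar y) with y ≡ᵇ x
  ... | true  = λ ()
  ... | false = λ m → m
  fv-closeAtm-⊆ k x (bvar i) ()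
  fv-closeAtm-⊆ k x (app R M) = ++⁺ (fv-closeAtm-⊆ k x R) (fv-closeTm-⊆ k x M)

fv-closeATy-⊆ : ∀ k x P → fvATy (closeATy k x P) ⊆ fvATy P
fv-closeATy-⊆ k x (tcon c) ()
fv-closeATy-⊆ k x (tapp P M) = ++⁺ (fv-closeATy-⊆ k x P) (fv-closeTm-⊆ k x M)

fv-closeTy-⊆ : ∀ k x A → fvTy (closeTy k x A) ⊆ fvTy A
fv-closeTy-⊆ k x (at P)   = fv-closeATy-⊆ k x P
fv-closeTy-⊆ k x (Pi A B) = ++⁺ (fv-closeTy-⊆ k x A) (fv-closeTy-⊆ (suc k) x B)

fv-closeKind-⊆ : ∀ k x K → fvKind (closeKind k x K) ⊆ fvKind K
fv-closeKind-⊆ k x Type ()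
fv-closeKind-⊆ k x (PiK A K) = ++⁺ (fv-closeTy-⊆ k x A) (fv-closeKind-⊆ (suc k) x K)

mutual
  fv-closeTm-∉ : ∀ k x M → x ∉ fvTm (closeTm k x M)
  fv-closeTm-∉ k x (rt R)  = fv-closeAtm-∉ k x R
  fv-closeTm-∉ k x (lam M) = fv-closeTm-∉ (suc k) x M

  fv-closeAtm-∉ : ∀ k x R → x ∉ fvAtm (closeAtm k x R)
  fv-closeAtm-∉ k x (con c) ()
  fv-closeAtm-∉ k x (fvar y) with y ≡ᵇ x in y≡ᵇx
  ... | true  = λ ()
  ... | false = λ { (here refl) → true≢false (trans (sym (≡ᵇ-refl x)) y≡ᵇx) }
    where
    true≢false : true ≢ false
    true≢false ()
  fv-closeAtm-∉ k x (bvar i) ()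
  fv-closeAtm-∉ k x (app R M) = ∉-++ (fv-closeAtm-∉ k x R) (fv-closeTm-∉ k x M)

fv-closeATy-∉ : ∀ k x P → x ∉ fvATy (closeATy k x P)
fv-closeATy-∉ k x (tcon c) ()
fv-closeATy-∉ k x (tapp P M) = ∉-++ (fv-closeATy-∉ k x P) (fv-closeTm-∉ k x M)

fv-closeTy-∉ : ∀ k x A → x ∉ fvTy (closeTy k x A)
fv-closeTy-∉ k x (at P)   = fv-closeATy-∉ k x P
fv-closeTy-∉ k x (Pi A B) = ∉-++ (fv-closeTy-∉ k x A) (fv-closeTy-∉ (suc k) x B)

fv-closeKind-∉ : ∀ k x K → x ∉ fvKind (closeKind k x K)
fv-closeKind-∉ k x Type ()
fv-closeKind-∉ k x (PiK A K) = ∉-++ (fv-closeTy-∉ k x A) (fv-closeKind-∉ (suc k) x K)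

swapTm-openTm-fresh : ∀ k M → x ∉ fvTm M → z ∉ fvTm M → swapTm x z (openTm k x M) ≡ openTm k z M
swapTm-openTm-fresh {x} {z} k M x∉ z∉ =
  trans (swapTm-openTm x z k x M) (cong₂ (openTm k) (swapVar-left x z) (swapTm-fresh M x∉ z∉))

swapTy-openTy-fresh : ∀ k A → x ∉ fvTy A → z ∉ fvTy A → swapTy x z (openTy k x A) ≡ openTy k z A
swapTy-openTy-fresh {x} {z} k A x∉ z∉ =
  trans (swapTy-openTy x z k x A) (cong₂ (openTy k) (swapVar-left x z) (swapTy-fresh A x∉ z∉))

swapKind-openKind-fresh : ∀ k K → x ∉ fvKind K → z ∉ fvKind K → swapKind x z (openKind k x K) ≡ openKind k z K
swapKind-openKind-fresh {x} {z} k K x∉ z∉ =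
  trans (swapKind-openKind x z k x K) (cong₂ (openKind k) (swapVar-left x z) (swapKind-fresh K x∉ z∉))

closeTm-rename : ∀ k N → z ∉ fvTm (closeTm k x N) → closeTm k x N ≡ closeTm k z (swapTm x z N)
closeTm-rename {z} {x} k N z∉ = begin
  closeTm k x N                             ≡⟨ sym (swapTm-fresh (closeTm k x N) (fv-closeTm-∉ k x N) z∉) ⟩
  swapTm x z (closeTm k x N)                ≡⟨ swapTm-closeTm x z k x N ⟩
  closeTm k (swapVar x z x) (swapTm x z N)  ≡⟨ cong (λ v → closeTm k v (swapTm x z N)) (swapVar-left x z) ⟩
  closeTm k z (swapTm x z N)                ∎
  where open ≡-Reasoning

closeTy-rename : ∀ k A → z ∉ fvTy (closeTy k x A) → closeTy k x A ≡ closeTy k z (swapTy x z A)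
closeTy-rename {z} {x} k A z∉ = begin
  closeTy k x A                             ≡⟨ sym (swapTy-fresh (closeTy k x A) (fv-closeTy-∉ k x A) z∉) ⟩
  swapTy x z (closeTy k x A)                ≡⟨ swapTy-closeTy x z k x A ⟩
  closeTy k (swapVar x z x) (swapTy x z A)  ≡⟨ cong (λ v → closeTy k v (swapTy x z A)) (swapVar-left x z) ⟩
  closeTy k z (swapTy x z A)                ∎
  where open ≡-Reasoning

closeKind-rename : ∀ k K → z ∉ fvKind (closeKind k x K) → closeKind k x K ≡ closeKind k z (swapKind x z K)
closeKind-rename {z} {x} k K z∉ = begin
  closeKind k x K                               ≡⟨ sym (swapKind-fresh (closeKind k x K) (fv-closeKind-∉ k x K) z∉) ⟩
  swapKind x z (closeKind k x K)                ≡⟨ swapKind-closeKind x z k x K ⟩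
  closeKind k (swapVar x z x) (swapKind x z K)  ≡⟨ cong (λ v → closeKind k v (swapKind x z K)) (swapVar-left x z) ⟩
  closeKind k z (swapKind x z K)                ∎
  where open ≡-Reasoning

-- Equivariance of hereditary substitution

swapSubst-∈ : (x , M , α) ∈ θ → (swapVar a b x , swapTm a b M , α) ∈ swapSubst a b θ
swapSubst-∈ (here refl) = here refl
swapSubst-∈ (there m)   = there (swapSubst-∈ m)

dom-swapSubst : ∀ a b θ → dom (swapSubst a b θ) ≡ map (swapVar a b) (dom θ)
dom-swapSubst a b []      = refl
dom-swapSubst a b (t ∷ θ) = cong (swapVar a b (proj₁ t) ∷_) (dom-swapSubst a b θ)

swapVar-∉dom : ∀ θ → x ∉ dom θ → swapVar a b x ∉ dom (swapSubst a b θ)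
swapVar-∉dom {a = a} {b} θ x∉ rewrite dom-swapSubst a b θ = swapVar-∉ x∉

swapVar-∉fvTm : ∀ M → x ∉ fvTm M → swapVar a b x ∉ fvTm (swapTm a b M)
swapVar-∉fvTm {a = a} {b} M x∉ rewrite fv-swapTm a b M = swapVar-∉ x∉

swapVar-∉fvTy : ∀ A → x ∉ fvTy A → swapVar a b x ∉ fvTy (swapTy a b A)
swapVar-∉fvTy {a = a} {b} A x∉ rewrite fv-swapTy a b A = swapVar-∉ x∉

swapVar-∉fvKind : ∀ K → x ∉ fvKind K → swapVar a b x ∉ fvKind (swapKind a b K)
swapVar-∉fvKind {a = a} {b} K x∉ rewrite fv-swapKind a b K = swapVar-∉ x∉

Fresh-swap : ∀ θ → Fresh x θ → Fresh (swapVar a b x) (swapSubst a b θ)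
Fresh-swap θ (x∉dom , x∉rng) = swapVar-∉dom θ x∉dom , fresh-rng θ x∉rng
  where
  fresh-rng : ∀ θ → All (λ t → x ∉ fvTm (proj₁ (proj₂ t))) θ →
              All (λ t → swapVar a b x ∉ fvTm (proj₁ (proj₂ t))) (swapSubst a b θ)
  fresh-rng []                []          = []
  fresh-rng ((_ , M , _) ∷ θ) (x∉M ∷ x∉θ) = swapVar-∉fvTm M x∉M ∷ fresh-rng θ x∉θ

swapSubst-fresh : ∀ θ → Fresh a θ → Fresh b θ → swapSubst a b θ ≡ θ
swapSubst-fresh []                _                       _                       = refl
swapSubst-fresh ((x , M , α) ∷ θ) (a∉dom , a∉M ∷ a∉rng) (b∉dom , b∉M ∷ b∉rng) =
  cong₂ _∷_
    (cong₂ _,_ (swapVar-other (a∉dom ∘ here ∘ sym) (b∉dom ∘ here ∘ sym))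
               (cong (_, α) (swapTm-fresh M a∉M b∉M)))
    (swapSubst-fresh θ (a∉dom ∘ there , a∉rng) (b∉dom ∘ there , b∉rng))

mutual
  HSTm-swap : HSTm θ M N → HSTm (swapSubst a b θ) (swapTm a b M) (swapTm a b N)
  HSTm-swap (hs-at D)  = hs-at (HSAtmA-swap D)
  HSTm-swap (hs-can D) = hs-can (HSAtmC-swap D)
  HSTm-swap {θ = θ} {a = a} {b} (hs-lam {M} {N} x x♯θ x∉M D) =
    subst (HSTm _ _ ∘ lam) (sym (swapTm-closeTm a b 0 x N))
      (hs-lam (swapVar a b x) (Fresh-swap θ x♯θ) (swapVar-∉fvTm M x∉M)
        (subst (λ t → HSTm _ t _) (swapTm-openTm a b 0 x M) (HSTm-swap D)))

  HSAtmC-swap : ∀ {β} → HSAtmC θ R M β → HSAtmC (swapSubst a b θ) (swapAtm a b R) (swapTm a b M) β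
  HSAtmC-swap (hsc-var m) = hsc-var (swapSubst-∈ m)
  HSAtmC-swap {a = a} {b} (hsc-app {body = body} D₁ D₂ x x∉body D₃) =
    hsc-app (HSAtmC-swap D₁) (HSTm-swap D₂) (swapVar a b x) (swapVar-∉fvTm body x∉body)
      (subst (λ t → HSTm _ t _) (swapTm-openTm a b 0 x body) (HSTm-swap D₃))

  HSAtmA-swap : ∀ {R'} → HSAtmA θ R R' → HSAtmA (swapSubst a b θ) (swapAtm a b R) (swapAtm a b R')
  HSAtmA-swap hsa-con                 = hsa-con
  HSAtmA-swap {θ = θ} (hsa-var x∉dom) = hsa-var (swapVar-∉dom θ x∉dom)
  HSAtmA-swap (hsa-app D₁ D₂)         = hsa-app (HSAtmA-swap D₁) (HSTm-swap D₂)

HSATy-swap : ∀ {P P'} → HSATy θ P P' → HSATy (swapSubst a b θ) (swapATy a b P) (swapATy a b P')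
HSATy-swap hs-tcon          = hs-tcon
HSATy-swap (hs-tapp D₁ D₂) = hs-tapp (HSATy-swap D₁) (HSTm-swap D₂)

HSTy-swap : ∀ {A A'} → HSTy θ A A' → HSTy (swapSubst a b θ) (swapTy a b A) (swapTy a b A')
HSTy-swap (hs-atTy D) = hs-atTy (HSATy-swap D)
HSTy-swap {θ = θ} {a = a} {b} (hs-Pi {A₂ = A₂} {A₂' = A₂'} x x♯θ x∉A₂ D₁ D₂) =
  subst (HSTy _ _ ∘ Pi _) (sym (swapTy-closeTy a b 0 x A₂'))
    (hs-Pi (swapVar a b x) (Fresh-swap θ x♯θ) (swapVar-∉fvTy A₂ x∉A₂) (HSTy-swap D₁)
      (subst (λ t → HSTy _ t _) (swapTy-openTy a b 0 x A₂) (HSTy-swap D₂)))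

HSKind-swap : ∀ {K K'} → HSKind θ K K' → HSKind (swapSubst a b θ) (swapKind a b K) (swapKind a b K')
HSKind-swap hs-Type = hs-Type
HSKind-swap {θ = θ} {a = a} {b} (hs-PiK {K = K} {K' = K'} x x♯θ x∉K D₁ D₂) =
  subst (HSKind _ _ ∘ PiK _) (sym (swapKind-closeKind a b 0 x K'))
    (hs-PiK (swapVar a b x) (Fresh-swap θ x♯θ) (swapVar-∉fvKind K x∉K) (HSTy-swap D₁)
      (subst (λ t → HSKind _ t _) (swapKind-openKind a b 0 x K) (HSKind-swap D₂)))

fvRng : Subst → List Var
fvRng []                = []
fvRng ((_ , M , _) ∷ θ) = fvTm M ++ fvRng θ

infix 4 _⊆[_]_
_⊆[_]_ : List Var → Subst → List Var → Set
ys ⊆[ θ ] xs = ∀ {y} → y ∈ ys → (y ∈ xs × y ∉ dom θ) ⊎ y ∈ fvRng θ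

⊆[]-mono : xs ⊆ xs' → ys ⊆[ θ ] xs → ys ⊆[ θ ] xs'
⊆[]-mono xs⊆ ys⊆ y∈ with ys⊆ y∈
... | inj₁ (y∈xs , y∉dom) = inj₁ (xs⊆ y∈xs , y∉dom)
... | inj₂ y∈rng          = inj₂ y∈rng

⊆[]-++ : ys ⊆[ θ ] xs → ys' ⊆[ θ ] xs' → ys ++ ys' ⊆[ θ ] xs ++ xs'
⊆[]-++ {ys = ys} {xs = xs} {xs' = xs'} ys⊆ ys'⊆ y∈ with ∈-++⁻ ys y∈
... | inj₁ y∈ys  = ⊆[]-mono (xs⊆xs++ys xs xs') ys⊆ y∈ys
... | inj₂ y∈ys' = ⊆[]-mono (xs⊆ys++xs xs' xs) ys'⊆ y∈ys'

⊆[]-unbind : ys' ⊆ ys → x ∉ ys' → ys ⊆[ θ ] xs → xs ⊆ x ∷ xs' → ys' ⊆[ θ ] xs'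
⊆[]-unbind ys'⊆ x∉ys' ys⊆ xs⊆ y∈ with ys⊆ (ys'⊆ y∈)
... | inj₂ y∈rng = inj₂ y∈rng
... | inj₁ (y∈xs , y∉dom) with xs⊆ y∈xs
...   | here refl = ⊥-elim (x∉ys' y∈)
...   | there y∈xs' = inj₁ (y∈xs' , y∉dom)

∈-fvRng : (x , M , α) ∈ θ → y ∈ fvTm M → y ∈ fvRng θ
∈-fvRng {θ = (_ , M , _) ∷ θ} (here refl) y∈ = ∈-++⁺ˡ y∈
∈-fvRng {θ = (_ , M , _) ∷ θ} (there m)   y∈ = ∈-++⁺ʳ (fvTm M) (∈-fvRng m y∈)

Fresh⇒∉fvRng : Fresh x θ → x ∉ fvRng θ
Fresh⇒∉fvRng {θ = []}    _                         ()
Fresh⇒∉fvRng {θ = _ ∷ _} (x∉dom , x∉M ∷ x∉rng) = ∉-++ x∉M (Fresh⇒∉fvRng (x∉dom ∘ there , x∉rng))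

Fresh-∉-⊆[] : Fresh z θ → z ∉ xs → ys ⊆[ θ ] xs → z ∉ ys
Fresh-∉-⊆[] z♯θ z∉xs ys⊆ z∈ys with ys⊆ z∈ys
... | inj₁ (z∈xs , _) = z∉xs z∈xs
... | inj₂ z∈rng      = Fresh⇒∉fvRng z♯θ z∈rng

mutual
  fv-HSTm : HSTm θ M N → fvTm N ⊆[ θ ] fvTm M
  fv-HSTm (hs-at D)  = fv-HSAtmA D
  fv-HSTm (hs-can D) = fv-HSAtmC D
  fv-HSTm (hs-lam {M} {N} x _ _ D) =
    ⊆[]-unbind (fv-closeTm-⊆ 0 x N) (fv-closeTm-∉ 0 x N) (fv-HSTm D) (fv-openTm-⊆ 0 x M)

  fv-HSAtmC : HSAtmC θ R M α → fvTm M ⊆[ θ ] fvAtm R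
  fv-HSAtmC (hsc-var m) y∈ = inj₂ (∈-fvRng m y∈)
  fv-HSAtmC (hsc-app {R = R} {M = M} {body} {M'' = M''} D₁ D₂ x _ D₃) y∈ with fv-HSTm D₃ y∈
  ... | inj₂ y∈M'' =
    ⊆[]-mono (xs⊆ys++xs (fvTm M) (fvAtm R)) (fv-HSTm D₂) (subst (λ l → _ ∈ l) (++-identityʳ (fvTm M'')) y∈M'')
  ... | inj₁ (y∈body , y≢x) with fv-openTm-⊆ 0 x body y∈body
  ...   | here y≡x     = ⊥-elim (y≢x (here y≡x))
  ...   | there y∈body' = ⊆[]-mono (xs⊆xs++ys (fvAtm R) (fvTm M)) (fv-HSAtmC D₁) y∈body'

  fv-HSAtmA : ∀ {R'} → HSAtmA θ R R' → fvAtm R' ⊆[ θ ] fvAtm R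
  fv-HSAtmA hsa-con ()
  fv-HSAtmA (hsa-var x∉dom) (here refl) = inj₁ (here refl , x∉dom)
  fv-HSAtmA (hsa-app D₁ D₂) = ⊆[]-++ (fv-HSAtmA D₁) (fv-HSTm D₂)

fv-HSATy : ∀ {P P'} → HSATy θ P P' → fvATy P' ⊆[ θ ] fvATy P
fv-HSATy hs-tcon ()
fv-HSATy (hs-tapp D₁ D₂) = ⊆[]-++ (fv-HSATy D₁) (fv-HSTm D₂)

mutual
  fv-HSTy : ∀ {A A'} → HSTy θ A A' → fvTy A' ⊆[ θ ] fvTy A
  fv-HSTy (hs-atTy D)         = fv-HSATy D
  fv-HSTy (hs-Pi x _ _ D₁ D₂) = ⊆[]-++ (fv-HSTy D₁) (fv-HSTy-body D₂)

  fv-HSTy-body : ∀ {A A'} → HSTy θ (openTy 0 x A) A' → fvTy (closeTy 0 x A') ⊆[ θ ] fvTy A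
  fv-HSTy-body {x = x} {A = A} {A'} D =
    ⊆[]-unbind (fv-closeTy-⊆ 0 x A') (fv-closeTy-∉ 0 x A') (fv-HSTy D) (fv-openTy-⊆ 0 x A)

mutual
  fv-HSKind : ∀ {K K'} → HSKind θ K K' → fvKind K' ⊆[ θ ] fvKind K
  fv-HSKind hs-Type ()
  fv-HSKind (hs-PiK x _ _ D₁ D₂) = ⊆[]-++ (fv-HSTy D₁) (fv-HSKind-body D₂)

  fv-HSKind-body : ∀ {K K'} → HSKind θ (openKind 0 x K) K' → fvKind (closeKind 0 x K') ⊆[ θ ] fvKind K
  fv-HSKind-body {x = x} {K = K} {K'} D =
    ⊆[]-unbind (fv-closeKind-⊆ 0 x K') (fv-closeKind-∉ 0 x K') (fv-HSKind D) (fv-openKind-⊆ 0 x K)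

-- Any fresh name can serve as the binder

HSTm-lam-inv : HSTm θ (lam M) N → Fresh z θ → z ∉ fvTm M →
               ∃ λ N' → HSTm θ (openTm 0 z M) N' × N ≡ lam (closeTm 0 z N')
HSTm-lam-inv {θ} {M} {z = z} D@(hs-lam {N = N} x x♯θ x∉M Dx) z♯θ z∉M =
  swapTm x z N , Dz , cong lam (closeTm-rename 0 N (Fresh-∉-⊆[] z♯θ z∉M (fv-HSTm D)))
  where
  Dz : HSTm θ (openTm 0 z M) (swapTm x z N)
  Dz = subst₂ (λ θ' M' → HSTm θ' M' _)
         (swapSubst-fresh θ x♯θ z♯θ) (swapTm-openTm-fresh 0 M x∉M z∉M) (HSTm-swap Dx)

HSTy-Pi-inv : ∀ {A₁ A₂ B} → HSTy θ (Pi A₁ A₂) B → Fresh z θ → z ∉ fvTy A₂ →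
              ∃₂ λ A₁' A₂' → HSTy θ A₁ A₁' × HSTy θ (openTy 0 z A₂) A₂' × B ≡ Pi A₁' (closeTy 0 z A₂')
HSTy-Pi-inv {θ} {z = z} {A₂ = A₂} (hs-Pi {A₁' = A₁'} {A₂' = A₂'} x x♯θ x∉A₂ D₁ D₂) z♯θ z∉A₂ =
  A₁' , swapTy x z A₂' , D₁ , D₂z ,
  cong (Pi A₁') (closeTy-rename 0 A₂' (Fresh-∉-⊆[] z♯θ z∉A₂ (fv-HSTy-body D₂)))
  where
  D₂z : HSTy θ (openTy 0 z A₂) (swapTy x z A₂')
  D₂z = subst₂ (λ θ' A → HSTy θ' A _)
          (swapSubst-fresh θ x♯θ z♯θ) (swapTy-openTy-fresh 0 A₂ x∉A₂ z∉A₂) (HSTy-swap D₂)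

HSKind-PiK-inv : ∀ {A K L} → HSKind θ (PiK A K) L → Fresh z θ → z ∉ fvKind K →
                 ∃₂ λ A' K' → HSTy θ A A' × HSKind θ (openKind 0 z K) K' × L ≡ PiK A' (closeKind 0 z K')
HSKind-PiK-inv {θ} {z = z} {K = K} (hs-PiK {A' = A'} {K' = K'} x x♯θ x∉K D₁ D₂) z♯θ z∉K =
  A' , swapKind x z K' , D₁ , D₂z ,
  cong (PiK A') (closeKind-rename 0 K' (Fresh-∉-⊆[] z♯θ z∉K (fv-HSKind-body D₂)))
  where
  D₂z : HSKind θ (openKind 0 z K) (swapKind x z K')
  D₂z = subst₂ (λ θ' K → HSKind θ' K _)
          (swapSubst-fresh θ x♯θ z♯θ) (swapKind-openKind-fresh 0 K x∉K z∉K) (HSKind-swap D₂)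

-- Renaming the substituted name of a single substitution

single : Var → Tm → Arity → Subst
single x N α = (x , N , α) ∷ []

Fresh-single : w ≢ x → w ∉ fvTm N → Fresh w (single x N α)
Fresh-single w≢x w∉N = (λ { (here w≡x) → w≢x w≡x }) , w∉N ∷ []

freshVar : List Var → Var
freshVar xs = suc (max 0 xs)

freshVar-∉ : ∀ xs → freshVar xs ∉ xs
freshVar-∉ xs m = 1+n≰n (All.lookup (xs≤max 0 xs) m)

mutual
  sizeTm : Tm → ℕ
  sizeTm (rt R)  = suc (sizeAtm R)
  sizeTm (lam M) = suc (sizeTm M)

  sizeAtm : Atm → ℕ
  sizeAtm (app R M) = suc (sizeAtm R + sizeTm M)
  sizeAtm _         = 1

mutual
  sizeTm-openTm : ∀ k x M → sizeTm (openTm k x M) ≡ sizeTm M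
  sizeTm-openTm k x (rt R)  = cong suc (sizeAtm-openAtm k x R)
  sizeTm-openTm k x (lam M) = cong suc (sizeTm-openTm (suc k) x M)

  sizeAtm-openAtm : ∀ k x R → sizeAtm (openAtm k x R) ≡ sizeAtm R
  sizeAtm-openAtm k x (con c)   = refl
  sizeAtm-openAtm k x (fvar y)  = refl
  sizeAtm-openAtm k x (bvar i) with i ≡ᵇ k
  ... | true  = refl
  ... | false = refl
  sizeAtm-openAtm k x (app R M) = cong suc (cong₂ _+_ (sizeAtm-openAtm k x R) (sizeTm-openTm k x M))

sizeTm-openTm-≤ : ∀ {n} k x M → sizeTm M ≤ n → sizeTm (openTm k x M) ≤ n
sizeTm-openTm-≤ k x M = subst (_≤ _) (sym (sizeTm-openTm k x M))

suc[m+n]≤suc⇒ : ∀ {m n k} → suc (m + n) ≤ suc k → m ≤ k × n ≤ k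
suc[m+n]≤suc⇒ {m} {n} (s≤s m+n≤k) = ≤-trans (m≤m+n m n) m+n≤k , ≤-trans (m≤n+m n m) m+n≤k

mutual
  renameTm : Var → Var → Tm → Tm
  renameTm y x (rt R)  = rt (renameAtm y x R)
  renameTm y x (lam M) = lam (renameTm y x M)

  renameAtm : Var → Var → Atm → Atm
  renameAtm y x (con c)   = con c
  renameAtm y x (fvar z)  = if z ≡ᵇ y then fvar x else fvar z
  renameAtm y x (bvar i)  = bvar i
  renameAtm y x (app R M) = app (renameAtm y x R) (renameTm y x M)

mutual
  renameTm-openTm : ∀ k M → w ≢ y → renameTm y x (openTm k w M) ≡ openTm k w (renameTm y x M)
  renameTm-openTm k (rt R)  w≢y = cong rt (renameAtm-openAtm k R w≢y)
  renameTm-openTm k (lam M) w≢y = cong lam (renameTm-openTm (suc k) M w≢y)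

  renameAtm-openAtm : ∀ k R → w ≢ y → renameAtm y x (openAtm k w R) ≡ openAtm k w (renameAtm y x R)
  renameAtm-openAtm k (con c) w≢y = refl
  renameAtm-openAtm {y = y} k (fvar z) w≢y with z ≡ᵇ y
  ... | true  = refl
  ... | false = refl
  renameAtm-openAtm k (bvar i) w≢y with i ≡ᵇ k
  ... | true rewrite ≢⇒≡ᵇ-false w≢y = refl
  ... | false = refl
  renameAtm-openAtm k (app R M) w≢y = cong₂ app (renameAtm-openAtm k R w≢y) (renameTm-openTm k M w≢y)

mutual
  renameTm-openTm-self : ∀ k M → y ∉ fvTm M → renameTm y x (openTm k y M) ≡ openTm k x M
  renameTm-openTm-self k (rt R)  y∉ = cong rt (renameAtm-openAtm-self k R y∉)
  renameTm-openTm-self k (lam M) y∉ = cong lam (renameTm-openTm-self (suc k) M y∉)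

  renameAtm-openAtm-self : ∀ k R → y ∉ fvAtm R → renameAtm y x (openAtm k y R) ≡ openAtm k x R
  renameAtm-openAtm-self k (con c) y∉ = refl
  renameAtm-openAtm-self k (fvar z) y∉ rewrite ≢⇒≡ᵇ-false (y∉ ∘ here ∘ sym) = refl
  renameAtm-openAtm-self {y = y} k (bvar i) y∉ with i ≡ᵇ k
  ... | true rewrite ≡ᵇ-refl y = refl
  ... | false = refl
  renameAtm-openAtm-self k (app R M) y∉ =
    cong₂ app (renameAtm-openAtm-self k R (∉-++ˡ y∉)) (renameTm-openTm-self k M (∉-++ʳ (fvAtm R) y∉))

mutual
  fv-renameTm-⊆ : ∀ M → fvTm (renameTm y x M) ⊆ x ∷ fvTm M
  fv-renameTm-⊆ (rt R)  = fv-renameAtm-⊆ R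
  fv-renameTm-⊆ (lam M) = fv-renameTm-⊆ M

  fv-renameAtm-⊆ : ∀ R → fvAtm (renameAtm y x R) ⊆ x ∷ fvAtm R
  fv-renameAtm-⊆ (con c) ()
  fv-renameAtm-⊆ {y = y} (fvar z) with z ≡ᵇ y
  ... | true  = λ { (here refl) → here refl }
  ... | false = there
  fv-renameAtm-⊆ (bvar i) ()
  fv-renameAtm-⊆ (app R M) = ⊆∷-++ (fv-renameAtm-⊆ R) (fv-renameTm-⊆ M)

-- Renaming rather than swapping: the substituted term N may mention x or y.
mutual
  HSTm-rename : ∀ {M'} n → sizeTm M ≤ n → x ∉ fvTm M →
                HSTm (single y N α) M M' → HSTm (single x N α) (renameTm y x M) M'
  HSTm-rename (suc n) (s≤s le) x∉ (hs-at D)  = hs-at (HSAtmA-rename n le x∉ D)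
  HSTm-rename (suc n) (s≤s le) x∉ (hs-can D) = hs-can (HSAtmC-rename n le x∉ D)
  HSTm-rename {M = lam M} {x} {y} {N} {α} {M'} (suc n) (s≤s le) x∉ D@(hs-lam _ _ _ _) =
    subst (HSTm _ _) (sym M'≡) (hs-lam v (Fresh-single v≢x v∉N) v∉renamed Dv)
    where
    avoided : List Var
    avoided = x ∷ y ∷ fvTm N ++ fvTm M
    v : Var
    v = freshVar avoided
    v∉ : v ∉ avoided
    v∉ = freshVar-∉ avoided
    v≢x : v ≢ x
    v≢x = v∉ ∘ here
    v≢y : v ≢ y
    v≢y = v∉ ∘ there ∘ here
    v∉N : v ∉ fvTm N
    v∉N = v∉ ∘ there ∘ there ∘ ∈-++⁺ˡ
    v∉M : v ∉ fvTm M
    v∉M = ∉-++ʳ (fvTm N) (v∉ ∘ there ∘ there)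
    v∉renamed : v ∉ fvTm (renameTm y x M)
    v∉renamed = ∉-⊆∷ (fv-renameTm-⊆ M) v≢x v∉M
    inv : ∃ λ N' → HSTm (single y N α) (openTm 0 v M) N' × M' ≡ lam (closeTm 0 v N')
    inv = HSTm-lam-inv D (Fresh-single v≢y v∉N) v∉M
    M'≡ : M' ≡ lam (closeTm 0 v (proj₁ inv))
    M'≡ = proj₂ (proj₂ inv)
    Dv : HSTm (single x N α) (openTm 0 v (renameTm y x M)) (proj₁ inv)
    Dv = subst (λ t → HSTm (single x N α) t (proj₁ inv)) (renameTm-openTm 0 M v≢y)
           (HSTm-rename n (sizeTm-openTm-≤ 0 v M le)
              (∉-⊆∷ (fv-openTm-⊆ 0 v M) (v≢x ∘ sym) x∉) (proj₁ (proj₂ inv)))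

  HSAtmC-rename : ∀ {M' β} n → sizeAtm R ≤ n → x ∉ fvAtm R →
                  HSAtmC (single y N α) R M' β → HSAtmC (single x N α) (renameAtm y x R) M' β
  HSAtmC-rename {y = y} n le x∉ (hsc-var (here refl)) rewrite ≡ᵇ-refl y = hsc-var (here refl)
  HSAtmC-rename {R = app R M} (suc n) le x∉ (hsc-app D₁ D₂ z z∉ D₃) =
    hsc-app (HSAtmC-rename n (proj₁ (suc[m+n]≤suc⇒ le)) (∉-++ˡ x∉) D₁)
            (HSTm-rename n (proj₂ (suc[m+n]≤suc⇒ le)) (∉-++ʳ (fvAtm R) x∉) D₂) z z∉ D₃

  HSAtmA-rename : ∀ {R'} n → sizeAtm R ≤ n → x ∉ fvAtm R →
                  HSAtmA (single y N α) R R' → HSAtmA (single x N α) (renameAtm y x R) R'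
  HSAtmA-rename n le x∉ hsa-con = hsa-con
  HSAtmA-rename {R = fvar z} {y = y} n le x∉ (hsa-var z∉dom) rewrite ≢⇒≡ᵇ-false (z∉dom ∘ here) =
    hsa-var λ { (here z≡x) → x∉ (here (sym z≡x)) }
  HSAtmA-rename {R = app R M} (suc n) le x∉ (hsa-app D₁ D₂) =
    hsa-app (HSAtmA-rename n (proj₁ (suc[m+n]≤suc⇒ le)) (∉-++ˡ x∉) D₁)
            (HSTm-rename n (proj₂ (suc[m+n]≤suc⇒ le)) (∉-++ʳ (fvAtm R) x∉) D₂)

HSTm-single-rebind : ∀ {B M'} → y ∉ fvTm B → x ∉ fvTm B →
                     HSTm (single y N α) (openTm 0 y B) M' → HSTm (single x N α) (openTm 0 x B) M'
HSTm-single-rebind {y} {x} {B = B} y∉B x∉B D with x ≟ y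
... | yes refl = D
... | no x≢y   =
  subst (λ t → HSTm _ t _) (renameTm-openTm-self 0 B y∉B)
    (HSTm-rename _ ≤-refl (∉-⊆∷ (fv-openTm-⊆ 0 y B) x≢y x∉B) D)

-- Uniqueness

IsSubst-lookup-unique : ∀ {M₁ M₂ α₁ α₂} → IsSubst θ →
                        (x , M₁ , α₁) ∈ θ → (x , M₂ , α₂) ∈ θ → M₁ ≡ M₂ × α₁ ≡ α₂
IsSubst-lookup-unique (_ ∷ _)       (here refl) (here refl) = refl , refl
IsSubst-lookup-unique (x∉θ ∷ _)     (here refl) (there m)   = ⊥-elim (All.lookup x∉θ (∈-map⁺ proj₁ m) refl)
IsSubst-lookup-unique (x∉θ ∷ _)     (there m)   (here refl) = ⊥-elim (All.lookup x∉θ (∈-map⁺ proj₁ m) refl)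
IsSubst-lookup-unique (_ ∷ θ-subst) (there m₁)  (there m₂)  = IsSubst-lookup-unique θ-subst m₁ m₂

HSAtmA⇒¬HSAtmC : ∀ {R'} → HSAtmA θ R R' → ¬ HSAtmC θ R M α
HSAtmA⇒¬HSAtmC (hsa-var x∉dom) (hsc-var m)         = x∉dom (∈-map⁺ proj₁ m)
HSAtmA⇒¬HSAtmC (hsa-app D _)   (hsc-app C _ _ _ _) = HSAtmA⇒¬HSAtmC D C

mutual
  HSTm-unique : ∀ {N₁ N₂} → IsSubst θ → HSTm θ M N₁ → HSTm θ M N₂ → N₁ ≡ N₂
  HSTm-unique θ-subst (hs-at D)  (hs-at E)  = cong rt (HSAtmA-unique θ-subst D E)
  HSTm-unique θ-subst (hs-at D)  (hs-can E) = ⊥-elim (HSAtmA⇒¬HSAtmC D E)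
  HSTm-unique θ-subst (hs-can D) (hs-at E)  = ⊥-elim (HSAtmA⇒¬HSAtmC E D)
  HSTm-unique θ-subst (hs-can D) (hs-can E) = proj₁ (HSAtmC-unique θ-subst D E)
  HSTm-unique θ-subst (hs-lam x x♯θ x∉M D) E with HSTm-lam-inv E x♯θ x∉M
  ... | _ , Ex , refl = cong (lam ∘ closeTm 0 x) (HSTm-unique θ-subst D Ex)

  HSAtmC-unique : ∀ {M₁ M₂ α₁ α₂} → IsSubst θ →
                  HSAtmC θ R M₁ α₁ → HSAtmC θ R M₂ α₂ → M₁ ≡ M₂ × α₁ ≡ α₂
  HSAtmC-unique θ-subst (hsc-var m₁) (hsc-var m₂) = IsSubst-lookup-unique θ-subst m₁ m₂
  HSAtmC-unique θ-subst (hsc-app D₁ D₂ x x∉ D₃) (hsc-app E₁ E₂ y y∉ E₃)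
    with HSAtmC-unique θ-subst D₁ E₁ | HSTm-unique θ-subst D₂ E₂
  ... | refl , refl | refl = HSTm-unique ([] ∷ []) D₃ (HSTm-single-rebind y∉ x∉ E₃) , refl

  HSAtmA-unique : ∀ {R₁ R₂} → IsSubst θ → HSAtmA θ R R₁ → HSAtmA θ R R₂ → R₁ ≡ R₂
  HSAtmA-unique θ-subst hsa-con         hsa-con         = refl
  HSAtmA-unique θ-subst (hsa-var _)     (hsa-var _)     = refl
  HSAtmA-unique θ-subst (hsa-app D₁ D₂) (hsa-app E₁ E₂) =
    cong₂ app (HSAtmA-unique θ-subst D₁ E₁) (HSTm-unique θ-subst D₂ E₂)

HSATy-unique : ∀ {P P₁ P₂} → IsSubst θ → HSATy θ P P₁ → HSATy θ P P₂ → P₁ ≡ P₂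
HSATy-unique θ-subst hs-tcon         hs-tcon         = refl
HSATy-unique θ-subst (hs-tapp D₁ D₂) (hs-tapp E₁ E₂) =
  cong₂ tapp (HSATy-unique θ-subst D₁ E₁) (HSTm-unique θ-subst D₂ E₂)

HSTy-unique : ∀ {A A₁ A₂} → IsSubst θ → HSTy θ A A₁ → HSTy θ A A₂ → A₁ ≡ A₂
HSTy-unique θ-subst (hs-atTy D) (hs-atTy E) = cong at (HSATy-unique θ-subst D E)
HSTy-unique θ-subst (hs-Pi x x♯θ x∉ D₁ D₂) E with HSTy-Pi-inv E x♯θ x∉
... | _ , _ , E₁ , E₂ , refl =
  cong₂ (λ A B → Pi A (closeTy 0 x B)) (HSTy-unique θ-subst D₁ E₁) (HSTy-unique θ-subst D₂ E₂)

HSKind-unique : ∀ {K K₁ K₂} → IsSubst θ → HSKind θ K K₁ → HSKind θ K K₂ → K₁ ≡ K₂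
HSKind-unique θ-subst hs-Type hs-Type = refl
HSKind-unique θ-subst (hs-PiK x x♯θ x∉ D₁ D₂) E with HSKind-PiK-inv E x♯θ x∉
... | _ , _ , E₁ , E₂ , refl =
  cong₂ (λ A K → PiK A (closeKind 0 x K)) (HSTy-unique θ-subst D₁ E₁) (HSKind-unique θ-subst D₂ E₂)

HSCtx-unique : ∀ {Γ Γ₁ Γ₂} → IsSubst θ → HSCtx θ Γ Γ₁ → HSCtx θ Γ Γ₂ → Γ₁ ≡ Γ₂
HSCtx-unique θ-subst hs-emp            hs-emp            = refl
HSCtx-unique θ-subst (hs-snoc _ D₁ D₂) (hs-snoc _ E₁ E₂) =
  cong₂ (λ Γ A → Γ , _ ∶ A) (HSCtx-unique θ-subst D₁ E₁) (HSTy-unique θ-subst D₂ E₂)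

-- Decidability

freshFor : List Var → Subst → Var
freshFor xs θ = freshVar (xs ++ dom θ ++ fvRng θ)

freshFor-∉ : ∀ xs θ → freshFor xs θ ∉ xs
freshFor-∉ xs θ = ∉-++ˡ (freshVar-∉ (xs ++ dom θ ++ fvRng θ))

freshFor-Fresh : ∀ xs θ → Fresh (freshFor xs θ) θ
freshFor-Fresh xs θ = ∉-++ˡ v∉ , ∉fvRng⇒All θ (∉-++ʳ (dom θ) v∉)
  where
  v∉ : freshFor xs θ ∉ dom θ ++ fvRng θ
  v∉ = ∉-++ʳ xs (freshVar-∉ (xs ++ dom θ ++ fvRng θ))
  ∉fvRng⇒All : ∀ θ → x ∉ fvRng θ → All (λ t → x ∉ fvTm (proj₁ (proj₂ t))) θ
  ∉fvRng⇒All []                x∉ = []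
  ∉fvRng⇒All ((_ , M , _) ∷ θ) x∉ = ∉-++ˡ x∉ ∷ ∉fvRng⇒All θ (∉-++ʳ (fvTm M) x∉)

Fresh? : ∀ x θ → Dec (Fresh x θ)
Fresh? x θ = ¬? (x ∈? dom θ) ×-dec all? (λ t → ¬? (x ∈? fvTm (proj₁ (proj₂ t)))) θ

depth : Arity → ℕ
depth o       = 0
depth (α ⇒ β) = suc (depth α ⊔ depth β)

AritiesBelow : ℕ → Subst → Set
AritiesBelow n θ = All (λ t → depth (proj₂ (proj₂ t)) < n) θ

maxDepth : Subst → ℕ
maxDepth θ = max 0 (map (depth ∘ proj₂ ∘ proj₂) θ)

AritiesBelow-maxDepth : ∀ θ → AritiesBelow (suc (maxDepth θ)) θ
AritiesBelow-maxDepth θ = All.map s≤s (All-map⁻ (xs≤max 0 (map (depth ∘ proj₂ ∘ proj₂) θ)))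

depth-HSAtmC : ∀ {n} → AritiesBelow n θ → HSAtmC θ R M α → depth α < n
depth-HSAtmC bound (hsc-var m) = All.lookup bound m
depth-HSAtmC bound (hsc-app {α' = α'} {α''} D _ _ _ _) =
  <-trans (s≤s (m≤n⊔m (depth α') (depth α''))) (depth-HSAtmC bound D)

HSAtmC-app-inv : ∀ {body α' α'' M'' M''' β} → IsSubst θ →
                 HSAtmC θ R (lam body) (α' ⇒ α'') → HSTm θ M M'' → x ∉ fvTm body →
                 HSAtmC θ (app R M) M''' β → HSTm (single x M'' α') (openTm 0 x body) M'''
HSAtmC-app-inv θ-subst D₁ D₂ x∉ (hsc-app E₁ E₂ y y∉ E₃)
  with HSAtmC-unique θ-subst D₁ E₁ | HSTm-unique θ-subst D₂ E₂
... | refl , refl | refl = HSTm-single-rebind y∉ x∉ E₃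

HSAtmResult : Subst → Atm → Set
HSAtmResult θ R = (∃ λ R' → HSAtmA θ R R') ⊎ (∃₂ λ M' α' → HSAtmC θ R M' α')

-- n bounds the arity depths in θ and s the size of the input; only the inner
-- substitution of a redex lowers n, since its arity α' is smaller than α' ⇒ α''.
mutual
  HSTm-dec : ∀ n s → IsSubst θ → AritiesBelow n θ → ∀ M → sizeTm M ≤ s → Dec (∃ (HSTm θ M))
  HSTm-dec n (suc s) θ-subst bound (rt R) (s≤s le) =
    map′ (λ { (inj₁ (_ , D)) → _ , hs-at D ; (inj₂ (_ , _ , D)) → _ , hs-can D })
         (λ { (_ , hs-at D) → inj₁ (_ , D) ; (_ , hs-can D) → inj₂ (_ , _ , D) })
         (HSAtm-dec n s θ-subst bound R le)
  HSTm-dec {θ} n (suc s) θ-subst bound (lam M) (s≤s le) =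
    HSLam-dec n s θ-subst bound M le (freshFor-Fresh (fvTm M) θ) (freshFor-∉ (fvTm M) θ)

  HSLam-dec : ∀ n s → IsSubst θ → AritiesBelow n θ → ∀ M → sizeTm M ≤ s →
              Fresh x θ → x ∉ fvTm M → Dec (∃ (HSTm θ (lam M)))
  HSLam-dec {x = x} n s θ-subst bound M le x♯θ x∉M =
    map′ (λ (_ , D) → _ , hs-lam x x♯θ x∉M D)
         (λ (_ , D) → let (N , Dx , _) = HSTm-lam-inv D x♯θ x∉M in N , Dx)
         (HSTm-dec n s θ-subst bound (openTm 0 x M) (sizeTm-openTm-≤ 0 x M le))

  HSAtm-dec : ∀ n s → IsSubst θ → AritiesBelow n θ → ∀ R → sizeAtm R ≤ s → Dec (HSAtmResult θ R)
  HSAtm-dec n s θ-subst bound (con c) le = yes (inj₁ (_ , hsa-con))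
  HSAtm-dec {θ} n s θ-subst bound (fvar x) le with x ∈? dom θ
  ... | no x∉dom = yes (inj₁ (_ , hsa-var x∉dom))
  ... | yes x∈dom with ∈-map⁻ proj₁ x∈dom
  ...   | _ , m , refl = yes (inj₂ (_ , _ , hsc-var m))
  HSAtm-dec n s θ-subst bound (bvar i) le = no λ { (inj₁ (_ , ())) ; (inj₂ (_ , _ , ())) }
  HSAtm-dec n (suc s) θ-subst bound (app R M) le =
    HSApp-dec n s θ-subst bound R M (proj₂ (suc[m+n]≤suc⇒ le))
      (HSAtm-dec n s θ-subst bound R (proj₁ (suc[m+n]≤suc⇒ le)))

  HSApp-dec : ∀ n s → IsSubst θ → AritiesBelow n θ → ∀ R M → sizeTm M ≤ s →
              Dec (HSAtmResult θ R) → Dec (HSAtmResult θ (app R M))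
  HSApp-dec n s θ-subst bound R M le (no ¬R) =
    no λ { (inj₁ (_ , hsa-app D _)) → ¬R (inj₁ (_ , D))
         ; (inj₂ (_ , _ , hsc-app D _ _ _ _)) → ¬R (inj₂ (_ , _ , D)) }
  HSApp-dec n s θ-subst bound R M le (yes (inj₁ (_ , DR))) =
    map′ (λ (_ , DM) → inj₁ (_ , hsa-app DR DM))
         (λ { (inj₁ (_ , hsa-app _ DM)) → _ , DM
            ; (inj₂ (_ , _ , hsc-app C _ _ _ _)) → ⊥-elim (HSAtmA⇒¬HSAtmC DR C) })
         (HSTm-dec n s θ-subst bound M le)
  HSApp-dec n s θ-subst bound R M le (yes (inj₂ (_ , _ , DR))) =
    HSRedex-dec n s θ-subst bound R M le DR

  HSRedex-dec : ∀ {M' α} n s → IsSubst θ → AritiesBelow n θ → ∀ R M → sizeTm M ≤ s →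
                HSAtmC θ R M' α → Dec (HSAtmResult θ (app R M))
  HSRedex-dec {M' = rt _} n s θ-subst bound R M le DR =
    no λ { (inj₁ (_ , hsa-app DA _)) → HSAtmA⇒¬HSAtmC DA DR
         ; (inj₂ (_ , _ , hsc-app C _ _ _ _)) → rt≢lam (proj₁ (HSAtmC-unique θ-subst DR C)) }
    where
    rt≢lam : ∀ {R M} → rt R ≢ lam M
    rt≢lam ()
  HSRedex-dec {M' = lam _} {α = o} n s θ-subst bound R M le DR =
    no λ { (inj₁ (_ , hsa-app DA _)) → HSAtmA⇒¬HSAtmC DA DR
         ; (inj₂ (_ , _ , hsc-app C _ _ _ _)) → o≢⇒ (proj₂ (HSAtmC-unique θ-subst DR C)) }
    where
    o≢⇒ : ∀ {α β} → o ≢ (α ⇒ β)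
    o≢⇒ ()
  HSRedex-dec {M' = lam _} {α = _ ⇒ _} n s θ-subst bound R M le DR
    with HSTm-dec n s θ-subst bound M le
  ... | no ¬M = no λ { (inj₁ (_ , hsa-app DA _)) → HSAtmA⇒¬HSAtmC DA DR
                     ; (inj₂ (_ , _ , hsc-app _ E _ _ _)) → ¬M (_ , E) }
  ... | yes (_ , DM) = HSβ-dec n θ-subst R M DR DM (depth-HSAtmC bound DR)

  HSβ-dec : ∀ {body α' α'' M''} n → IsSubst θ → ∀ R M →
            HSAtmC θ R (lam body) (α' ⇒ α'') → HSTm θ M M'' → depth (α' ⇒ α'') < n →
            Dec (HSAtmResult θ (app R M))
  HSβ-dec {body = body} {α'} {α''} {M''} (suc n) θ-subst R M DR DM (s≤s depth≤n) =
    map′ (λ (_ , D) → inj₂ (_ , _ , hsc-app DR DM v v∉body D))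
         (λ { (inj₁ (_ , hsa-app DA _)) → ⊥-elim (HSAtmA⇒¬HSAtmC DA DR)
            ; (inj₂ (_ , _ , C)) → _ , HSAtmC-app-inv θ-subst DR DM v∉body C })
         (HSTm-dec n (sizeTm (openTm 0 v body)) ([] ∷ [])
            (≤-trans (s≤s (m≤m⊔n (depth α') (depth α''))) depth≤n ∷ []) (openTm 0 v body) ≤-refl)
    where
    v : Var
    v = freshVar (fvTm body)
    v∉body : v ∉ fvTm body
    v∉body = freshVar-∉ (fvTm body)

HSTm? : IsSubst θ → ∀ M → Dec (∃ (HSTm θ M))
HSTm? {θ} θ-subst M = HSTm-dec _ (sizeTm M) θ-subst (AritiesBelow-maxDepth θ) M ≤-refl

HSAtm? : IsSubst θ → ∀ R → Dec (HSAtmResult θ R)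
HSAtm? {θ} θ-subst R = HSAtm-dec _ (sizeAtm R) θ-subst (AritiesBelow-maxDepth θ) R ≤-refl

HSATy? : IsSubst θ → ∀ P → Dec (∃ (HSATy θ P))
HSATy? θ-subst (tcon a)   = yes (_ , hs-tcon)
HSATy? θ-subst (tapp P M) =
  map′ (λ ((_ , D₁) , (_ , D₂)) → _ , hs-tapp D₁ D₂)
       (λ { (_ , hs-tapp D₁ D₂) → (_ , D₁) , (_ , D₂) })
       (HSATy? θ-subst P ×-dec HSTm? θ-subst M)

sizeTy : Ty → ℕ
sizeTy (at P)   = 1
sizeTy (Pi A B) = suc (sizeTy A + sizeTy B)

sizeTy-openTy : ∀ k x A → sizeTy (openTy k x A) ≡ sizeTy A
sizeTy-openTy k x (at P)   = refl
sizeTy-openTy k x (Pi A B) = cong suc (cong₂ _+_ (sizeTy-openTy k x A) (sizeTy-openTy (suc k) x B))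

HSTy-dec : ∀ s → IsSubst θ → ∀ A → sizeTy A ≤ s → Dec (∃ (HSTy θ A))
HSTy-dec s θ-subst (at P) le =
  map′ (λ (_ , D) → _ , hs-atTy D) (λ { (_ , hs-atTy D) → _ , D }) (HSATy? θ-subst P)
HSTy-dec {θ} (suc s) θ-subst (Pi A B) le =
  map′ (λ ((_ , D₁) , (_ , D₂)) → _ , hs-Pi v v♯θ v∉B D₁ D₂)
       (λ (_ , D) → let (_ , _ , D₁ , D₂ , _) = HSTy-Pi-inv D v♯θ v∉B in (_ , D₁) , (_ , D₂))
       (HSTy-dec s θ-subst A (proj₁ (suc[m+n]≤suc⇒ le)) ×-dec
        HSTy-dec s θ-subst (openTy 0 v B)
          (subst (_≤ s) (sym (sizeTy-openTy 0 v B)) (proj₂ (suc[m+n]≤suc⇒ le))))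
  where
  v : Var
  v = freshFor (fvTy B) θ
  v♯θ : Fresh v θ
  v♯θ = freshFor-Fresh (fvTy B) θ
  v∉B : v ∉ fvTy B
  v∉B = freshFor-∉ (fvTy B) θ

HSTy? : IsSubst θ → ∀ A → Dec (∃ (HSTy θ A))
HSTy? θ-subst A = HSTy-dec (sizeTy A) θ-subst A ≤-refl

sizeKind : Kind → ℕ
sizeKind Type      = 1
sizeKind (PiK A K) = suc (sizeKind K)

sizeKind-openKind : ∀ k x K → sizeKind (openKind k x K) ≡ sizeKind K
sizeKind-openKind k x Type      = refl
sizeKind-openKind k x (PiK A K) = cong suc (sizeKind-openKind (suc k) x K)

HSKind-dec : ∀ s → IsSubst θ → ∀ K → sizeKind K ≤ s → Dec (∃ (HSKind θ K))
HSKind-dec s θ-subst Type le = yes (_ , hs-Type)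
HSKind-dec {θ} (suc s) θ-subst (PiK A K) (s≤s le) =
  map′ (λ ((_ , D₁) , (_ , D₂)) → _ , hs-PiK v v♯θ v∉K D₁ D₂)
       (λ (_ , D) → let (_ , _ , D₁ , D₂ , _) = HSKind-PiK-inv D v♯θ v∉K in (_ , D₁) , (_ , D₂))
       (HSTy? θ-subst A ×-dec
        HSKind-dec s θ-subst (openKind 0 v K) (subst (_≤ s) (sym (sizeKind-openKind 0 v K)) le))
  where
  v : Var
  v = freshFor (fvKind K) θ
  v♯θ : Fresh v θ
  v♯θ = freshFor-Fresh (fvKind K) θ
  v∉K : v ∉ fvKind K
  v∉K = freshFor-∉ (fvKind K) θ

HSKind? : IsSubst θ → ∀ K → Dec (∃ (HSKind θ K))
HSKind? θ-subst K = HSKind-dec (sizeKind K) θ-subst K ≤-refl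

HSCtx? : IsSubst θ → ∀ Γ → Dec (∃ (HSCtx θ Γ))
HSCtx? θ-subst ·           = yes (_ , hs-emp)
HSCtx? {θ} θ-subst (Γ , x ∶ A) =
  map′ (λ (x♯θ , (_ , D₁) , (_ , D₂)) → _ , hs-snoc x♯θ D₁ D₂)
       (λ { (_ , hs-snoc x♯θ D₁ D₂) → x♯θ , (_ , D₁) , (_ , D₂) })
       (Fresh? x θ ×-dec HSCtx? θ-subst Γ ×-dec HSTy? θ-subst A)

theorem2p4 : (θ : Subst) → IsSubst θ →
    ((Γ : Ctx) → Dec (∃ λ Γ' → HSCtx θ Γ Γ')
               × (∀ Γ₁ Γ₂ → HSCtx θ Γ Γ₁ → HSCtx θ Γ Γ₂ → Γ₁ ≡ Γ₂))
  × ((K : Kind) → Dec (∃ λ K' → HSKind θ K K')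
                × (∀ K₁ K₂ → HSKind θ K K₁ → HSKind θ K K₂ → K₁ ≡ K₂))
  × ((A : Ty) → Dec (∃ λ A' → HSTy θ A A')
              × (∀ A₁ A₂ → HSTy θ A A₁ → HSTy θ A A₂ → A₁ ≡ A₂))
  × ((M : Tm) → Dec (∃ λ M' → HSTm θ M M')
              × (∀ M₁ M₂ → HSTm θ M M₁ → HSTm θ M M₂ → M₁ ≡ M₂))
  × ((R : Atm) → Dec ((∃ λ R' → HSAtmA θ R R') ⊎ (∃₂ λ M' α' → HSAtmC θ R M' α'))
               × (∀ R' M' α' → HSAtmA θ R R' → ¬ HSAtmC θ R M' α')
               × (∀ R₁ R₂ → HSAtmA θ R R₁ → HSAtmA θ R R₂ → R₁ ≡ R₂)
               × (∀ M₁ α₁ M₂ α₂ → HSAtmC θ R M₁ α₁ → HSAtmC θ R M₂ α₂ →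
                    (M₁ ≡ M₂ × α₁ ≡ α₂)))
theorem2p4 θ θ-subst =
  (λ Γ → HSCtx? θ-subst Γ , λ _ _ → HSCtx-unique θ-subst) ,
  (λ K → HSKind? θ-subst K , λ _ _ → HSKind-unique θ-subst) ,
  (λ A → HSTy? θ-subst A , λ _ _ → HSTy-unique θ-subst) ,
  (λ M → HSTm? θ-subst M , λ _ _ → HSTm-unique θ-subst) ,
  (λ R → HSAtm? θ-subst R ,
         (λ _ _ _ → HSAtmA⇒¬HSAtmC) ,
         (λ _ _ → HSAtmA-unique θ-subst) ,
         (λ _ _ _ _ → HSAtmC-unique θ-subst))
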